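{- Let $\Gamma=(V_0,V_1,E,w)$ be a game graph, $k\in\mathbb{N}$, $K=\{0,\dots,k\}$, and $\mathcal{E}:K^V\to K^V$ given by $\mathcal{E}(a)(v)=\min_{(v,v')\in E}a(v')\ominus_{\mathbb{Z}}w(v,v')$ for $v\in V_0$ and $\mathcal{E}(a)(v)=\max_{(v,v')\in E}a(v')\ominus_{\mathbb{Z}}w(v,v')$ for $v\in V_1$, with $x\ominus_{\mathbb{Z}}y=\min\{\max\{x-y,0\},k\}$. Let $a\in K^V$ and $V'\subseteq[V]^a$. Then $v\in\mathcal{E}^a_\#(V')$ if $v\in[V]^{\mathcal{E}(a)}$ and (i) whenever $v\in V_0$: there exists $(v,v'')\in E$ with $a(v'')\ominus_{\mathbb{Z}}w(v,v'')=\min_{(v,v')\in E}a(v')\ominus_{\mathbb{Z}}w(v,v')$, $0<a(v'')-w(v,v'')\le k$ and $v''\in V'$; (ii) whenever $v\in V_1$: for every $(v,v'')\in E$ with $a(v'')\ominus_{\mathbb{Z}}w(v,v'')=\max_{(v,v')\in E}a(v')\ominus_{\mathbb{Z}}w(v,v')$ we have $0<a(v'')-w(v,v'')\le k$ and $v''\in V'$.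
   Context: A game graph is $\Gamma=(V_0,V_1,E,w)$ with $V=V_0\cup V_1$ a finite set, $V_0\cap V_1=\emptyset$, $E\subseteq V\times V$ such that every state has at least one outgoing edge, and $w:E\to\mathbb{Z}$. $K=\{0,\dots,k\}$ is the MV-chain with $n\oplus m=\min\{n+m,k\}$, complement $\overline{n}=k-n$, usual order, and $n\ominus m=\max\{n-m,0\}$, extended pointwise to $K^V$; $\mathcal{E}$ is non-expansive. For $a\in K^V$, $[V]^a=\{v\mid a(v)\neq0\}$; $\delta_{V'}$ is $\delta$ on $V'$ and $0$ elsewhere. For non-expansive $g:K^V\to K^V$ and $0<\delta\in K$, $g^{a,\delta}_\#:\mathcal{P}([V]^a)\to\mathcal{P}([V]^{g(a)})$ is $g^{a,\delta}_\#(V')=\{v\in[V]^{g(a)}\mid g(a)(v)\ominus g(a\ominus\delta_{V'})(v)\ge\delta\}$; these coincide for all $0<\delta\le\iota$ for some $\iota>0$, and the $a$-approximation $g^a_\#$ is this common function. -}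

module Defs where

open import Data.Nat using (ℕ; zero; suc; _⊓_; _⊔_; _∸_; _≤_; _<_)
open import Data.Integer as ℤ using (ℤ; +_; -[1+_])
open import Data.Fin using (Fin)
open import Data.Fin.Subset using (Subset; _∈_)
open import Data.Bool using (Bool; true; false; if_then_else_; T)
open import Data.Bool.Properties using (T?)
open import Data.List using (List; filter; map; foldr)
open import Data.List.Base using (allFin)
open import Data.Vec using (lookup)
open import Data.Product using (Σ; ∃; _×_)
open import Relation.Binary.PropositionalEquality using (_≡_; _≢_)

-- The two players owning the states: V = V₀ ∪ V₁ (disjoint) is encoded by
-- an ownership function on the finite state set V = Fin n.
data Player : Set where
  P0 P1 : Player

-- E is a (decidable, Bool-valued) edge relation; every state has an
-- outgoing edge; w assigns integer weights (only values on edges matter).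
record GameGraph (n : ℕ) : Set where
  field
    owner : Fin n → Player
    E     : Fin n → Fin n → Bool
    total : ∀ v → ∃ λ v' → E v v' ≡ true
    w     : Fin n → Fin n → ℤ

-- Elements of K = {0,…,k} are naturals ≤ k; K^V is Fin n → ℕ together
-- with the hypothesis InK.
InK : ∀ {n} → ℕ → (Fin n → ℕ) → Set
InK k a = ∀ v → a v ≤ k

clip : ℕ → ℤ → ℕ
clip k (+ m)      = m ⊓ k
clip k -[1+ _ ]   = 0

_⊖ℤ[_]_ : ℕ → ℕ → ℤ → ℕ
x ⊖ℤ[ k ] y = clip k (+ x ℤ.- y)

module _ {n : ℕ} (k : ℕ) (Γ : GameGraph n) where
  open GameGraph Γ

  succs : Fin n → List (Fin n)
  succs v = filter (λ v' → T? (E v v')) (allFin n)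

  edgeVals : (Fin n → ℕ) → Fin n → List ℕ
  edgeVals a v = map (λ v' → a v' ⊖ℤ[ k ] w v v') (succs v)

  -- min / max over the (nonempty, by totality) list of values, all of which
  -- lie in K; seeds k resp. 0 are neutral for ⊓ resp. ⊔ on K.
  minE : (Fin n → ℕ) → Fin n → ℕ
  minE a v = foldr _⊓_ k (edgeVals a v)

  maxE : (Fin n → ℕ) → Fin n → ℕ
  maxE a v = foldr _⊔_ 0 (edgeVals a v)

  𝓔 : (Fin n → ℕ) → (Fin n → ℕ)
  𝓔 a v with owner v
  ... | P0 = minE a v
  ... | P1 = maxE a v

δ[_]_ : ∀ {n} → ℕ → Subset n → Fin n → ℕ
(δ[ d ] V') u = if lookup V' u then d else 0

_⊖_ : ∀ {n} → (Fin n → ℕ) → (Fin n → ℕ) → Fin n → ℕ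
(a ⊖ b) u = a u ∸ b u

_∈[V]^_ : ∀ {n} → Fin n → (Fin n → ℕ) → Set
v ∈[V]^ a = a v ≢ 0

_∈approxδ[_,_,_]_ : ∀ {n} → Fin n → ((Fin n → ℕ) → (Fin n → ℕ)) →
                    (Fin n → ℕ) → ℕ → Subset n → Set
v ∈approxδ[ g , a , d ] V' =
  (v ∈[V]^ g a) × (d ≤ g a v ∸ g (a ⊖ (δ[ d ] V')) v)

_∈approx[_,_,_]_ : ∀ {n} → Fin n → ℕ → ((Fin n → ℕ) → (Fin n → ℕ)) →
                   (Fin n → ℕ) → Subset n → Set
v ∈approx[ k , g , a ] V' =
  Σ ℕ λ ι → (0 < ι) × (ι ≤ k) ×
    (∀ d → 0 < d → d ≤ ι → v ∈approxδ[ g , a , d ] V')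

{-# OPTIONS --safe #-}
-- For v ∈ V₀ the minimum
-- drops because the minimising edge into V' loses one unit of value (its
-- value a(v'') − w(v,v'') lies strictly inside (0, k], so clipping does not
-- absorb the change).  For v ∈ V₁ every maximising edge loses a unit and no
-- edge gains, so the maximum drops as well.  Hence v ∈ 𝓔^{a,1}_#(V'), and
-- since K is discrete, ι = 1 witnesses membership in 𝓔^a_#(V').
module Submission where

open import Defs
open import Data.Nat using (ℕ)
open import Data.Integer using (ℤ; +_; _-_; _<_; _≤_)
open import Data.Fin using (Fin)
open import Data.Fin.Subset using (Subset; _∈_)
open import Data.Bool using (true)
open import Data.Product using (Σ; _×_)
open import Relation.Binary.PropositionalEquality using (_≡_)

open import Data.Nat as ℕ using (suc; _⊓_; _⊔_; _∸_; z≤n; s≤s)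
open import Data.Nat.Properties
  using (_≟_; ≤-refl; ≤-reflexive; ≤-trans; ≤-<-trans; <-≤-trans; ≤∧≢⇒<; n≢0⇒n>0;
         m⊓n≤m; m⊓n≤n; m≤m⊔n; m≤n⊔m; ⊔-lub; ⊓-monoˡ-≤; m≤n⇒m⊓n≡m; m∸n≤m; m<n⇒0<n∸m)
import Data.Integer as ℤ
open import Data.Integer.Properties using (+-monoˡ-≤; +-assoc; drop‿+≤+)
open import Data.Bool using (T)
open import Data.Bool.Properties using (T?)
open import Data.Unit using (tt)
open import Data.Empty using (⊥-elim)
open import Data.Product using (_,_; proj₂)
open import Data.List using (List; []; _∷_; foldr; allFin)
open import Data.List.Properties using (foldr-preservesᵇ)
open import Data.List.Relation.Unary.All as All using (All)
open import Data.List.Relation.Unary.All.Properties using (map⁺)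
open import Data.List.Relation.Unary.Any using (here; there)
import Data.List.Membership.Propositional as List
open import Data.List.Membership.Propositional.Properties
  using (∈-map⁺; ∈-filter⁺; ∈-filter⁻; ∈-allFin)
open import Data.Vec.Properties using ([]=⇒lookup)
open import Relation.Nullary using (yes; no)
open import Relation.Binary.PropositionalEquality using (refl; sym; _≢_; subst)

foldr-⊓-≤ : ∀ {e x} {xs : List ℕ} → x List.∈ xs → foldr _⊓_ e xs ℕ.≤ x
foldr-⊓-≤ (here refl) = m⊓n≤m _ _
foldr-⊓-≤ (there x∈xs) = ≤-trans (m⊓n≤n _ _) (foldr-⊓-≤ x∈xs)

≤-foldr-⊔ : ∀ {e x} {xs : List ℕ} → x List.∈ xs → x ℕ.≤ foldr _⊔_ e xs
≤-foldr-⊔ (here refl) = m≤m⊔n _ _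
≤-foldr-⊔ (there x∈xs) = ≤-trans (≤-foldr-⊔ x∈xs) (m≤n⊔m _ _)

foldr-⊓-≤-seed : ∀ e (xs : List ℕ) → foldr _⊓_ e xs ℕ.≤ e
foldr-⊓-≤-seed e [] = ≤-refl
foldr-⊓-≤-seed e (x ∷ xs) = ≤-trans (m⊓n≤n x _) (foldr-⊓-≤-seed e xs)

-- ⊔-lub also serves for strict bounds, since suc m ⊔ suc n reduces to suc (m ⊔ n).
foldr-⊔-< : ∀ {e M} {xs : List ℕ} → e ℕ.< M → All (ℕ._< M) xs → foldr _⊔_ e xs ℕ.< M
foldr-⊔-< = foldr-preservesᵇ ⊔-lub

foldr-⊔-≤ : ∀ {e M} {xs : List ℕ} → e ℕ.≤ M → All (ℕ._≤ M) xs → foldr _⊔_ e xs ℕ.≤ M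
foldr-⊔-≤ = foldr-preservesᵇ ⊔-lub

clip≤k : ∀ k z → clip k z ℕ.≤ k
clip≤k k (+ m) = m⊓n≤n m k
clip≤k k ℤ.-[1+ _ ] = z≤n

clip-mono-≤ : ∀ k {z z'} → z ℤ.≤ z' → clip k z ℕ.≤ clip k z'
clip-mono-≤ k ℤ.-≤+ = z≤n
clip-mono-≤ k (ℤ.-≤- _) = z≤n
clip-mono-≤ k (ℤ.+≤+ m≤n) = ⊓-monoˡ-≤ k m≤n

clip-<-suc : ∀ k z → + 0 < ℤ.suc z → ℤ.suc z ≤ + k → clip k z ℕ.< clip k (ℤ.suc z)
clip-<-suc k (+ m) _ suc≤k rewrite m≤n⇒m⊓n≡m (drop‿+≤+ suc≤k) = s≤s (m⊓n≤m m k)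
clip-<-suc k ℤ.-[1+ 0 ] (ℤ.+<+ ()) _
clip-<-suc k ℤ.-[1+ suc _ ] () _

⊖ℤ-monoˡ-≤ : ∀ k {x y} z → x ℕ.≤ y → x ⊖ℤ[ k ] z ℕ.≤ y ⊖ℤ[ k ] z
⊖ℤ-monoˡ-≤ k z x≤y = clip-mono-≤ k (+-monoˡ-≤ (ℤ.- z) (ℤ.+≤+ x≤y))

⊖ℤ-pred-< : ∀ k {x} z → x ≢ 0 → + 0 < + x - z → + x - z ≤ + k →
            (x ∸ 1) ⊖ℤ[ k ] z ℕ.< x ⊖ℤ[ k ] z
⊖ℤ-pred-< k {0} z x≢0 _ _ = ⊥-elim (x≢0 refl)
⊖ℤ-pred-< k {suc y} z _ 0<x-z x-z≤k
  rewrite +-assoc (+ 1) (+ y) (ℤ.- z) = clip-<-suc k (+ y - z) 0<x-z x-z≤k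

⊖δ-∈ : ∀ {n} (a : Fin n → ℕ) d {V' : Subset n} {u} → u ∈ V' → (a ⊖ (δ[ d ] V')) u ≡ a u ∸ d
⊖δ-∈ a d u∈V' rewrite []=⇒lookup u∈V' = refl

module _ {n : ℕ} (k : ℕ) (Γ : GameGraph n) where
  open GameGraph Γ

  E⇒∈succs : ∀ {v u} → E v u ≡ true → u List.∈ succs k Γ v
  E⇒∈succs {v} {u} e = ∈-filter⁺ (λ u → T? (E v u)) (∈-allFin u) (subst T (sym e) tt)

  ∈succs⇒E : ∀ {v u} → u List.∈ succs k Γ v → E v u ≡ true
  ∈succs⇒E {v} {u} u∈ with E v u | proj₂ (∈-filter⁻ (λ u → T? (E v u)) {xs = allFin n} u∈)
  ... | true | _ = refl

  ∈-edgeVals : ∀ a {v u} → u List.∈ succs k Γ v → a u ⊖ℤ[ k ] w v u List.∈ edgeVals k Γ a v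
  ∈-edgeVals a {v} = ∈-map⁺ (λ u → a u ⊖ℤ[ k ] w v u)

  𝓔≤k : ∀ a v → 𝓔 k Γ a v ℕ.≤ k
  𝓔≤k a v with owner v
  ... | P0 = foldr-⊓-≤-seed k (edgeVals k Γ a v)
  ... | P1 = foldr-⊔-≤ z≤n
               (map⁺ {xs = succs k Γ v} (All.tabulate (λ {u} _ → clip≤k k (+ a u - w v u))))

  SensitiveEdge : (Fin n → ℕ) → Subset n → Fin n → Fin n → Set
  SensitiveEdge a V' v u = (+ 0 < + a u - w v u) × (+ a u - w v u ≤ + k) × (u ∈ V')

  SensitiveMinimiser : (Fin n → ℕ) → Subset n → Fin n → Set
  SensitiveMinimiser a V' v =
    Σ (Fin n) λ u → (E v u ≡ true) × (a u ⊖ℤ[ k ] w v u ≡ minE k Γ a v) × SensitiveEdge a V' v u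

  MaximisersSensitive : (Fin n → ℕ) → Subset n → Fin n → Set
  MaximisersSensitive a V' v =
    ∀ u → E v u ≡ true → a u ⊖ℤ[ k ] w v u ≡ maxE k Γ a v → SensitiveEdge a V' v u

  module _ (a : Fin n → ℕ) (V' : Subset n) (V'⊆[V]^a : ∀ u → u ∈ V' → u ∈[V]^ a) where

    ⊖δ-⊖ℤ-≤ : ∀ v u → (a ⊖ (δ[ 1 ] V')) u ⊖ℤ[ k ] w v u ℕ.≤ a u ⊖ℤ[ k ] w v u
    ⊖δ-⊖ℤ-≤ v u = ⊖ℤ-monoˡ-≤ k (w v u) (m∸n≤m (a u) ((δ[ 1 ] V') u))

    ⊖δ-⊖ℤ-< : ∀ v u → SensitiveEdge a V' v u →
              (a ⊖ (δ[ 1 ] V')) u ⊖ℤ[ k ] w v u ℕ.< a u ⊖ℤ[ k ] w v u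
    ⊖δ-⊖ℤ-< v u (0<a-w , a-w≤k , u∈V') rewrite ⊖δ-∈ a 1 u∈V' =
      ⊖ℤ-pred-< k (w v u) (V'⊆[V]^a u u∈V') 0<a-w a-w≤k

    minE-⊖δ-< : ∀ v → SensitiveMinimiser a V' v →
      minE k Γ (a ⊖ (δ[ 1 ] V')) v ℕ.< minE k Γ a v
    minE-⊖δ-< v (u , e , u-min , sensitive) =
      ≤-<-trans (foldr-⊓-≤ (∈-edgeVals (a ⊖ (δ[ 1 ] V')) (E⇒∈succs e)))
                (<-≤-trans (⊖δ-⊖ℤ-< v u sensitive) (≤-reflexive u-min))

    maxE-⊖δ-< : ∀ v → 0 ℕ.< maxE k Γ a v → MaximisersSensitive a V' v →
      maxE k Γ (a ⊖ (δ[ 1 ] V')) v ℕ.< maxE k Γ a v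
    maxE-⊖δ-< v 0<max maximisers-sensitive =
      foldr-⊔-< 0<max (map⁺ {xs = succs k Γ v} (All.tabulate drops))
      where
      drops : ∀ {u} → u List.∈ succs k Γ v →
              (a ⊖ (δ[ 1 ] V')) u ⊖ℤ[ k ] w v u ℕ.< maxE k Γ a v
      drops {u} u∈succs with a u ⊖ℤ[ k ] w v u ≟ maxE k Γ a v
      ... | yes u-max = <-≤-trans
              (⊖δ-⊖ℤ-< v u (maximisers-sensitive u (∈succs⇒E u∈succs) u-max)) (≤-reflexive u-max)
      ... | no u-not-max = ≤-<-trans (⊖δ-⊖ℤ-≤ v u)
              (≤∧≢⇒< (≤-foldr-⊔ (∈-edgeVals a u∈succs)) u-not-max)

    𝓔-⊖δ-< : ∀ v → v ∈[V]^ 𝓔 k Γ a →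
      (owner v ≡ P0 → SensitiveMinimiser a V' v) →
      (owner v ≡ P1 → MaximisersSensitive a V' v) →
      𝓔 k Γ (a ⊖ (δ[ 1 ] V')) v ℕ.< 𝓔 k Γ a v
    𝓔-⊖δ-< v v∈[V]^𝓔a min-case max-case with owner v
    ... | P0 = minE-⊖δ-< v (min-case refl)
    ... | P1 = maxE-⊖δ-< v (n≢0⇒n>0 v∈[V]^𝓔a) (max-case refl)

mainTheorem15 :
    ∀ {n : ℕ} (Γ : GameGraph n) (k : ℕ) (a : Fin n → ℕ) → InK k a →
    (V' : Subset n) → (∀ u → u ∈ V' → u ∈[V]^ a) →
    (v : Fin n) → v ∈[V]^ 𝓔 k Γ a →
    (GameGraph.owner Γ v ≡ P0 →
      Σ (Fin n) λ v'' → (GameGraph.E Γ v v'' ≡ true) ×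
        (a v'' ⊖ℤ[ k ] GameGraph.w Γ v v'' ≡ minE k Γ a v) ×
        (+ 0 < + a v'' - GameGraph.w Γ v v'') ×
        (+ a v'' - GameGraph.w Γ v v'' ≤ + k) × (v'' ∈ V')) →
    (GameGraph.owner Γ v ≡ P1 →
      ∀ v'' → GameGraph.E Γ v v'' ≡ true →
        a v'' ⊖ℤ[ k ] GameGraph.w Γ v v'' ≡ maxE k Γ a v →
        (+ 0 < + a v'' - GameGraph.w Γ v v'') ×
        (+ a v'' - GameGraph.w Γ v v'' ≤ + k) × (v'' ∈ V')) →
    v ∈approx[ k , 𝓔 k Γ , a ] V'
mainTheorem15 Γ k a _ V' V'⊆[V]^a v v∈[V]^𝓔a min-case max-case =
  1 , s≤s z≤n , ≤-trans (n≢0⇒n>0 v∈[V]^𝓔a) (𝓔≤k k Γ a v) , only-δ=1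
  where
  only-δ=1 : ∀ d → 0 ℕ.< d → d ℕ.≤ 1 → v ∈approxδ[ 𝓔 k Γ , a , d ] V'
  only-δ=1 .1 (s≤s z≤n) (s≤s z≤n) =
    v∈[V]^𝓔a , m<n⇒0<n∸m (𝓔-⊖δ-< k Γ a V' V'⊆[V]^a v v∈[V]^𝓔a min-case max-case)
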